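{- Let $G$ be a connected graph and let $S_e$ and $S_f$ be equivalence classes of $\mathcal{C}_G$. If $V(S_e)\setminus V(S_f)$, $V(S_f)\setminus V(S_e)$ and $V(S_e)\cap V(S_f)$ are all nonempty, then there is no pair of vertices $u,v\in V(S_e)\cap V(S_f)$ such that $uv\in S_e$ or $uv\in S_f$.
   Context: A quasi-transitive $2$-edge-colouring of a graph $G$ is a map $c: E(G)\to\{R,B\}$ such that for all pairs of edges $xy, yz \in E(G)$ with $c(xy)\neq c(yz)$, we have $xz\in E(G)$. $\mathcal{C}_G$ is the equivalence relation on $E(G)$ with $e\sim f$ iff $c(e)=c(f)$ for every quasi-transitive $2$-edge-colouring $c$ of $G$. For a set of edges $E$, $V(E)$ denotes the set of endpoints of edges in $E$. -}

module Defs where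

open import Data.Nat using (ℕ)
open import Data.Fin using (Fin)
open import Data.Product using (Σ; _×_; ∃-syntax)
open import Data.Sum using (_⊎_)
open import Relation.Nullary using (¬_)
open import Relation.Binary.PropositionalEquality using (_≡_)

record Graph (n : ℕ) : Set₁ where
  field
    Adj       : Fin n → Fin n → Set
    sym       : ∀ {x y} → Adj x y → Adj y x
    irrefl    : ∀ {x} → ¬ Adj x x

open Graph public

data Reach {n : ℕ} (G : Graph n) : Fin n → Fin n → Set where
  here  : ∀ {x} → Reach G x x
  step  : ∀ {x y z} → Adj G x y → Reach G y z → Reach G x z

Connected : ∀ {n} → Graph n → Set
Connected G = ∀ x y → Reach G x y

data Colour : Set where
  R B : Colour

-- A 2-edge-colouring: a colour assigned to every (ordered) pair of vertices,
-- symmetric on edges, so that an edge {x,y} gets the well-defined colour c x y.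
-- Values on non-edges are irrelevant.
IsEdgeColouring : ∀ {n} → Graph n → (Fin n → Fin n → Colour) → Set
IsEdgeColouring G c = ∀ {x y} → Adj G x y → c x y ≡ c y x

QuasiTransitive : ∀ {n} → Graph n → (Fin n → Fin n → Colour) → Set
QuasiTransitive G c =
  ∀ {x y z} → Adj G x y → Adj G y z → ¬ (c x y ≡ c y z) → Adj G x z

IsQTColouring : ∀ {n} → Graph n → (Fin n → Fin n → Colour) → Set
IsQTColouring G c = IsEdgeColouring G c × QuasiTransitive G c

EdgeEquiv : ∀ {n} → Graph n → Fin n → Fin n → Fin n → Fin n → Set
EdgeEquiv {n} G x y a b =
  (c : Fin n → Fin n → Colour) → IsQTColouring G c → c x y ≡ c a b

-- Membership of an edge {u,v} in the class S_{xy} of the edge {x,y}.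
InClass : ∀ {n} → Graph n → (x y : Fin n) → (u v : Fin n) → Set
InClass G x y u v = Adj G u v × EdgeEquiv G u v x y

InV : ∀ {n} → Graph n → (x y : Fin n) → Fin n → Set
InV G x y w = ∃[ z ] InClass G x y w z

module Submission where

open import Defs
open import Data.Nat using (zero; suc)
open import Data.Fin using (Fin; zero; suc)
open import Data.Product using (_×_; ∃-syntax; _,_; proj₁; proj₂)
open import Data.Sum using (_⊎_; inj₁; inj₂)
open import Relation.Binary.Definitions using (Symmetric)
open import Relation.Nullary using (¬_; Dec; yes; no)
open import Relation.Nullary.Negation using (contradiction)
open import Relation.Nullary.Decidable using (¬¬-excluded-middle)
open import Relation.Binary.PropositionalEquality
  using (_≡_; _≢_; refl; trans; module ≡-Reasoning) renaming (sym to ≡-sym)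

-- Every quasi-transitive colouring must give the two edges of an induced path
-- x – y – z the same colour, so an equivalence class of C_G is closed under
-- such steps. Conversely, colouring an edge red iff it lies in a class S and
-- satisfies a relation P that is preserved along induced paths inside S gives
-- a quasi-transitive colouring; hence such a P holds on all of S or on none
-- of it. With P = "both endpoints see w" this shows that a vertex outside
-- V(S) adjacent to one vertex of V(S) is adjacent to all of them, and with
-- P = "both endpoints lie in V(S_f)" it shows that once one edge of S_e lies
-- inside V(S_f), all of V(S_e) does. Since V(S_e) ⊈ V(S_f) and
-- V(S_f) ⊈ V(S_e), no edge of S_e or S_f joins two common vertices.

¬¬-∀-Fin : ∀ {n} {P : Fin n → Set} → (∀ i → ¬ ¬ P i) → ¬ ¬ (∀ i → P i)
¬¬-∀-Fin {zero}  ¬¬P ¬∀ = ¬∀ λ ()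
¬¬-∀-Fin {suc n} ¬¬P ¬∀ =
  ¬¬P zero λ P₀ → ¬¬-∀-Fin (λ i → ¬¬P (suc i)) λ Pₛ →
    ¬∀ λ { zero → P₀ ; (suc i) → Pₛ i }

¬¬-decidable₂ : ∀ {n} (P : Fin n → Fin n → Set) → ¬ ¬ (∀ i j → Dec (P i j))
¬¬-decidable₂ P =
  ¬¬-∀-Fin λ i → ¬¬-∀-Fin λ j → ¬¬-excluded-middle

colourOf : {X : Set} → Dec X → Colour
colourOf (yes _) = R
colourOf (no _)  = B

colourOf-yes : {X : Set} (d : Dec X) → X → colourOf d ≡ R
colourOf-yes (yes _) _ = refl
colourOf-yes (no ¬x) x = contradiction x ¬x

colourOf-no : {X : Set} (d : Dec X) → ¬ X → colourOf d ≡ B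
colourOf-no (yes x) ¬x = contradiction x ¬x
colourOf-no (no _)  _  = refl

colourOf-cong : {X Y : Set} → (X → Y) → (Y → X) →
                (d : Dec X) (e : Dec Y) → colourOf d ≡ colourOf e
colourOf-cong f g (yes _) (yes _) = refl
colourOf-cong f g (no _)  (no _)  = refl
colourOf-cong f g (yes x) (no ¬y) = contradiction (f x) ¬y
colourOf-cong f g (no ¬x) (yes y) = contradiction (g y) ¬x

R≢B : R ≢ B
R≢B ()

_≟ᶜ_ : (c d : Colour) → Dec (c ≡ d)
R ≟ᶜ R = yes refl
B ≟ᶜ B = yes refl
R ≟ᶜ B = no λ ()
B ≟ᶜ R = no λ ()

module _ {n} (G : Graph n) where

  InducedPath : Fin n → Fin n → Fin n → Set
  InducedPath x y z = Adj G x y × Adj G y z × ¬ Adj G x z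

  InducedPath-reverse : ∀ {x y z} → InducedPath x y z → InducedPath z y x
  InducedPath-reverse (axy , ayz , ¬axz) =
    sym G ayz , sym G axy , λ azx → ¬axz (sym G azx)

  EdgeEquiv-sym : ∀ {p q r s} → EdgeEquiv G p q r s → EdgeEquiv G r s p q
  EdgeEquiv-sym e c qt = ≡-sym (e c qt)

  EdgeEquiv-trans : ∀ {p q r s t u} →
    EdgeEquiv G p q r s → EdgeEquiv G r s t u → EdgeEquiv G p q t u
  EdgeEquiv-trans e e′ c qt = trans (e c qt) (e′ c qt)

  InducedPath⇒EdgeEquiv : ∀ {x y z} → InducedPath x y z → EdgeEquiv G x y y z
  InducedPath⇒EdgeEquiv {x} {y} {z} (axy , ayz , ¬axz) c (_ , quasi) with c x y ≟ᶜ c y z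
  ... | yes same = same
  ... | no  diff = contradiction (quasi axy ayz diff) ¬axz

  InClass-sym : ∀ {a b p q} → InClass G a b p q → InClass G a b q p
  InClass-sym (apq , e) = sym G apq , λ c qt → trans (≡-sym (proj₁ qt apq)) (e c qt)

  InClass-step : ∀ {a b x y z} → InducedPath x y z →
                 InClass G a b x y → InClass G a b y z
  InClass-step path (_ , e) =
    proj₁ (proj₂ path) , EdgeEquiv-trans (EdgeEquiv-sym (InducedPath⇒EdgeEquiv path)) e

  InducedPath⇒InV : ∀ {a b w p q} → InducedPath w p q → InClass G a b p q → InV G a b w
  InducedPath⇒InV path (_ , e) =
    _ , proj₁ path , EdgeEquiv-trans (InducedPath⇒EdgeEquiv path) e

  PreservedInClass : (a b : Fin n) → (Fin n → Fin n → Set) → Set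
  PreservedInClass a b P =
    ∀ {x y z} → InducedPath x y z → InClass G a b y z → P x y → P y z

  module RedBlue (a b : Fin n) {P : Fin n → Fin n → Set}
                 (P-sym : Symmetric P) (P-step : PreservedInClass a b P)
                 (adj? : ∀ i j → Dec (Adj G i j))
                 (red? : ∀ i j → Dec (InClass G a b i j × P i j)) where

    Red : Fin n → Fin n → Set
    Red i j = InClass G a b i j × P i j

    Red-sym : ∀ {i j} → Red i j → Red j i
    Red-sym (cls , p) = InClass-sym cls , P-sym p

    Red-step : ∀ {x y z} → InducedPath x y z → Red x y → Red y z
    Red-step path (cls , p) = cls′ , P-step path cls′ p
      where cls′ = InClass-step path cls

    colouring : Fin n → Fin n → Colour
    colouring i j = colourOf (red? i j)

    isQTColouring : IsQTColouring G colouring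
    isQTColouring = symmetric , quasiTransitive
      where
        symmetric : IsEdgeColouring G colouring
        symmetric {i} {j} _ = colourOf-cong Red-sym Red-sym (red? i j) (red? j i)

        quasiTransitive : QuasiTransitive G colouring
        quasiTransitive {x} {y} {z} axy ayz diff with adj? x z
        ... | yes axz = axz
        ... | no ¬axz = contradiction
          (colourOf-cong (Red-step path)
            (λ r → Red-sym (Red-step (InducedPath-reverse path) (Red-sym r)))
            (red? x y) (red? y z))
          diff
          where path = axy , ayz , ¬axz

  -- The red/blue colouring needs decidable adjacency and redness; as the goal
  -- is a negation, both can be assumed via the finite double-negation shift.
  class-uniform : ∀ a b {P : Fin n → Fin n → Set} →
    Symmetric P → PreservedInClass a b P →
    ∀ {p q r s} → InClass G a b p q → P p q → InClass G a b r s → ¬ ¬ P r s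
  class-uniform a b {P} P-sym P-step {p} {q} {r} {s} cpq ppq crs ¬prs =
    ¬¬-decidable₂ (Adj G) λ adj? →
    ¬¬-decidable₂ (λ i j → InClass G a b i j × P i j) λ red? →
    let open RedBlue a b P-sym P-step adj? red?
        qt = isQTColouring
    in R≢B (begin
      R                ≡⟨ ≡-sym (colourOf-yes (red? p q) (cpq , ppq)) ⟩
      colouring p q    ≡⟨ proj₂ cpq colouring qt ⟩
      colouring a b    ≡⟨ ≡-sym (proj₂ crs colouring qt) ⟩
      colouring r s    ≡⟨ colourOf-no (red? r s) (λ red → ¬prs (proj₂ red)) ⟩
      B                ∎)
    where open ≡-Reasoning

  adjacent-along-class : ∀ {a b w p q} → ¬ InV G a b w →
    InClass G a b p q → Adj G w p → ¬ ¬ Adj G w q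
  adjacent-along-class w∉V cpq awp ¬awq =
    w∉V (InducedPath⇒InV (awp , proj₁ cpq , ¬awq) cpq)

  outside-neighbour-adjacent : ∀ {a b w p q} → ¬ InV G a b w →
    InV G a b p → InV G a b q → Adj G w p → ¬ ¬ Adj G w q
  outside-neighbour-adjacent {a} {b} {w} w∉V (_ , cpp′) (_ , cqq′) awp ¬awq =
    class-uniform a b (λ (i , j) → j , i) adjacency-preserved cpp′
      ((λ ¬awp → ¬awp awp) , adjacent-along-class w∉V cpp′ awp) cqq′
      λ (¬¬awq , _) → ¬¬awq ¬awq
    where
      adjacency-preserved : PreservedInClass a b (λ i j → ¬ ¬ Adj G w i × ¬ ¬ Adj G w j)
      adjacency-preserved _ cyz (_ , ¬¬awy) =
        ¬¬awy , λ ¬awz → ¬¬awy λ awy → adjacent-along-class w∉V cyz awy ¬awz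

  class-inside-V : ∀ {x y a b u v w} → InClass G x y u v →
    InV G a b u → InV G a b v → InV G x y w → ¬ ¬ InV G a b w
  class-inside-V {x} {y} {a} {b} cuv u∈V v∈V (_ , cww′) w∉V =
    class-uniform x y (λ (i , j) → j , i) membership-preserved cuv
      ((λ u∉V → u∉V u∈V) , (λ v∉V → v∉V v∈V)) cww′
      λ (¬¬w∈V , _) → ¬¬w∈V w∉V
    where
      membership-preserved : PreservedInClass x y (λ i j → ¬ ¬ InV G a b i × ¬ ¬ InV G a b j)
      membership-preserved (_ , ajz , ¬aiz) _ (¬¬i∈V , ¬¬j∈V) =
        ¬¬j∈V , λ z∉V → ¬¬i∈V λ i∈V → ¬¬j∈V λ j∈V →
          outside-neighbour-adjacent z∉V j∈V i∈V (sym G ajz)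
            λ azi → ¬aiz (sym G azi)

-- Connectivity and the common vertex are hypotheses of the paper's statement
-- that the argument does not use.
theorem22 : ∀ {n} (G : Graph n) → Connected G →
    (x y a b : Fin n) → Adj G x y → Adj G a b →
    (∃[ w ] (InV G x y w × ¬ InV G a b w)) →
    (∃[ w ] (InV G a b w × ¬ InV G x y w)) →
    (∃[ w ] (InV G x y w × InV G a b w)) →
    ¬ (∃[ u ] ∃[ v ] ((InV G x y u × InV G a b u) × (InV G x y v × InV G a b v)
         × (InClass G x y u v ⊎ InClass G a b u v)))
theorem22 G _ x y a b _ _ (_ , w∈Vxy , w∉Vab) _ _ (_ , _ , (_ , u∈Vab) , (_ , v∈Vab) , inj₁ cuv) =
  class-inside-V G cuv u∈Vab v∈Vab w∈Vxy w∉Vab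
theorem22 G _ x y a b _ _ _ (_ , w∈Vab , w∉Vxy) _ (_ , _ , (u∈Vxy , _) , (v∈Vxy , _) , inj₂ cuv) =
  class-inside-V G cuv u∈Vxy v∈Vxy w∈Vab w∉Vxy
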